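{- Let $(E_1, \ldots, E_m)$ be a partition of $\mathbb{Z}^2$ and let $h_1, \ldots, h_m \in \mathbb{Z}^2$ satisfy $E_i + h_i = E_i$ for all $i$. Suppose no two of the $h_i$ (for distinct indices) are proportional to each other. Then each $E_i$ is periodic, i.e. for each $i$ there is a finite index subgroup $\Lambda \subseteq \mathbb{Z}^2$ with $E_i + \Lambda = E_i$.
   Context: Two elements $a, b \in \mathbb{Z}^2$ are proportional if they are linearly dependent over $\mathbb{Q}$. -}

module Defs where

open import Data.Nat using (ℕ)
open import Data.Integer as ℤ using (ℤ)
open import Data.Rational as ℚ using (ℚ)
open import Data.Product using (_×_; _,_; Σ; ∃; ∃-syntax)
open import Data.List using (List)
open import Data.List.Relation.Unary.Any using (Any)
open import Relation.Binary.PropositionalEquality using (_≡_)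
open import Relation.Nullary using (¬_)

ℤ² : Set
ℤ² = ℤ × ℤ

0² : ℤ²
0² = (ℤ.0ℤ , ℤ.0ℤ)

infixl 6 _+²_ _-²_
_+²_ : ℤ² → ℤ² → ℤ²
(a , b) +² (c , d) = (a ℤ.+ c , b ℤ.+ d)

-²_ : ℤ² → ℤ²
-² (a , b) = (ℤ.- a , ℤ.- b)

_-²_ : ℤ² → ℤ² → ℤ²
x -² y = x +² (-² y)

Proportional : ℤ² → ℤ² → Set
Proportional (a₁ , a₂) (b₁ , b₂) =
  ∃[ p ] ∃[ q ] ( ¬ (p ≡ ℚ.0ℚ × q ≡ ℚ.0ℚ)
                × (p ℚ.* (a₁ ℚ./ 1) ℚ.+ q ℚ.* (b₁ ℚ./ 1) ≡ ℚ.0ℚ)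
                × (p ℚ.* (a₂ ℚ./ 1) ℚ.+ q ℚ.* (b₂ ℚ./ 1) ≡ ℚ.0ℚ) )

record IsSubgroup (Λ : ℤ² → Set) : Set where
  field
    contains-0 : Λ 0²
    closed-+   : ∀ x y → Λ x → Λ y → Λ (x +² y)
    closed-neg : ∀ x → Λ x → Λ (-² x)

FiniteIndex : (ℤ² → Set) → Set
FiniteIndex Λ = ∃[ rs ] (∀ (x : ℤ²) → Any (λ r → Λ (x -² r)) rs)

-- Fix a colour i and let f = 𝟙[Eᵢ] : ℤ² → ℤ.  It is bounded and hᵢ-periodic.
-- Let Δ_b g (x) = g (x + b) − g x and apply the product D of the operators
-- Δ_{hⱼ}, j ≠ i, to the identity  ∑ⱼ 𝟙[Eⱼ] = 1.  Each Δ_{hⱼ} kills 𝟙[Eⱼ] and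
-- all the operators kill constants, so D f is constant.
--
-- The heart of the proof ('difference-periodicity') is an induction on the
-- number of operators: if f is bounded, has a period a, and Δ_{b₁}⋯Δ_{bₖ} f
-- is constant with every bₗ independent of a, then f is invariant under
-- Nℤ × Nℤ for some N ≥ 1.  In the inductive step Δ_b f is such a function,
-- so f has N·b as a period after all: Δ_{Nb} f is b-periodic, so f grows
-- linearly along N·b, which a bounded function can only do with slope 0.  Two
-- independent periods a, N·b then generate a lattice containing Mℤ × Mℤ
-- with M = |det(a, N·b)|.  Finally, non-proportionality means nonzero
-- determinant, and Nℤ × Nℤ is a subgroup of finite index.

module Submission where

open import Defs
open import Data.Nat as ℕ using (ℕ; zero; suc)
import Data.Nat.Properties as ℕP
import Data.Nat.Coprimality as Coprimality
open import Data.Integer as ℤ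
  using (ℤ; +_; -[1+_]; 0ℤ; 1ℤ; _+_; _-_; _*_; -_; ∣_∣; _≟_)
import Data.Integer.Properties as ℤP
import Data.Integer.DivMod as ℤD
open import Data.Integer.Tactic.RingSolver using (solve-∀)
open import Data.Rational as ℚ using (ℚ; mkℚ)
open import Data.Rational.Properties using (normalize-coprime)
open import Data.Fin as Fin using (Fin)
open import Data.Fin.Properties using (suc-injective)
open import Data.Product using (_×_; _,_; Σ; ∃₂)
open import Data.Sum using ([_,_]′)
open import Data.Empty using (⊥-elim)
open import Data.Bool using (if_then_else_)
open import Data.List using (List; []; _∷_; map; filter; allFin; upTo; cartesianProduct)
open import Data.List.Relation.Unary.Any as Any using (Any; here; there)
open import Data.List.Relation.Unary.All as All using (All; []; _∷_)
open import Data.List.Relation.Unary.All.Properties as AllP using (all-filter)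
open import Data.List.Membership.Propositional.Properties
  using (∈-map⁺; ∈-allFin; ∈-filter⁺; ∈-upTo⁺; ∈-cartesianProduct⁺)
open import Algebra.Properties.Monoid.Sum ℤP.+-0-monoid using (sum)
open import Function.Bundles using (_⇔_; mk⇔; module Equivalence)
open import Relation.Nullary using (¬_; yes; no; does; ¬?)
open import Relation.Nullary.Decidable using (_×-dec_)
open import Relation.Binary.PropositionalEquality
open ≡-Reasoning

infixr 7 _·²_
_·²_ : ℤ → ℤ² → ℤ²
k ·² (u , v) = (k * u , k * v)

+²-assoc : ∀ x u v → (x +² u) +² v ≡ x +² (u +² v)
+²-assoc (x , y) (u , v) (s , t) = cong₂ _,_ (ℤP.+-assoc x u s) (ℤP.+-assoc y v t)

+²-swap : ∀ x u v → (x +² u) +² v ≡ (x +² v) +² u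
+²-swap (x , y) (u , v) (s , t) = cong₂ _,_ (swap x u s) (swap y v t)
  where
  swap : ∀ a b c → (a + b) + c ≡ (a + c) + b
  swap = solve-∀

+²-identityʳ : ∀ x → x +² 0² ≡ x
+²-identityʳ (x , y) = cong₂ _,_ (ℤP.+-identityʳ x) (ℤP.+-identityʳ y)

-²-cancel : ∀ x u → (x -² u) +² u ≡ x
-²-cancel (x , y) (u , v) = cong₂ _,_ (cancel x u) (cancel y v)
  where
  cancel : ∀ a b → (a - b) + b ≡ a
  cancel = solve-∀

Period : {A : Set} → (ℤ² → A) → ℤ² → Set
Period f u = ∀ x → f (x +² u) ≡ f x

module _ {A : Set} (f : ℤ² → A) where

  period-0 : Period f 0²
  period-0 x = cong f (+²-identityʳ x)

  period-+ : ∀ {u v} → Period f u → Period f v → Period f (u +² v)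
  period-+ {u} {v} pu pv x = begin
    f (x +² (u +² v))  ≡⟨ cong f (+²-assoc x u v) ⟨
    f ((x +² u) +² v)  ≡⟨ pv (x +² u) ⟩
    f (x +² u)         ≡⟨ pu x ⟩
    f x                ∎

  period-neg : ∀ {u} → Period f u → Period f (-² u)
  period-neg {u} pu x = begin
    f (x -² u)         ≡⟨ pu (x -² u) ⟨
    f ((x -² u) +² u)  ≡⟨ cong f (-²-cancel x u) ⟩
    f x                ∎

  period-ℕ· : ∀ {u} → Period f u → ∀ n → Period f (+ n ·² u)
  period-ℕ· {u₁ , u₂} pu zero =
    subst (Period f) (sym (cong₂ _,_ (ℤP.*-zeroˡ u₁) (ℤP.*-zeroˡ u₂))) period-0
  period-ℕ· {u₁ , u₂} pu (suc n) =
    subst (Period f) (cong₂ _,_ (succ (+ n) u₁) (succ (+ n) u₂)) (period-+ pu (period-ℕ· pu n))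
    where
    succ : ∀ m a → a + m * a ≡ (1ℤ + m) * a
    succ = solve-∀

  period-ℤ· : ∀ {u} → Period f u → ∀ k → Period f (k ·² u)
  period-ℤ· pu (+ n) = period-ℕ· pu n
  period-ℤ· {u₁ , u₂} pu -[1+ n ] =
    subst (Period f) (cong₂ _,_ (ℤP.neg-distribˡ-* (+ suc n) u₁) (ℤP.neg-distribˡ-* (+ suc n) u₂))
      (period-neg (period-ℕ· pu (suc n)))

  period-lincomb : ∀ {u v} → Period f u → Period f v → ∀ k l → Period f (k ·² u +² l ·² v)
  period-lincomb pu pv k l = period-+ (period-ℤ· pu k) (period-ℤ· pv l)

Square : ℕ → ℤ² → Set
Square N y = ∃₂ λ k₁ k₂ → y ≡ (k₁ * + N , k₂ * + N)

square-subgroup : ∀ N → IsSubgroup (Square N)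
square-subgroup N = record
  { contains-0 = 0ℤ , 0ℤ , refl
  ; closed-+   = λ { _ _ (k₁ , k₂ , refl) (l₁ , l₂ , refl) →
      k₁ + l₁ , k₂ + l₂ , sym (cong₂ _,_ (ℤP.*-distribʳ-+ (+ N) k₁ l₁) (ℤP.*-distribʳ-+ (+ N) k₂ l₂)) }
  ; closed-neg = λ { _ (k₁ , k₂ , refl) →
      - k₁ , - k₂ , cong₂ _,_ (ℤP.neg-distribˡ-* k₁ (+ N)) (ℤP.neg-distribˡ-* k₂ (+ N)) }
  }

-- Every x ∈ ℤ² lies in the coset of its componentwise remainder mod N.
square-finiteIndex : ∀ n → FiniteIndex (Square (suc n))
square-finiteIndex n = map point (cartesianProduct (upTo N) (upTo N)) , cover
  where
  N = suc n
  point : ℕ × ℕ → ℤ²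
  point (a , b) = (+ a , + b)
  quotient : ∀ x → x - + (x ℤD.%ℕ N) ≡ (x ℤD./ℕ N) * + N
  quotient x = begin
    x - + r                  ≡⟨ cong (_- + r) (ℤD.a≡a%ℕn+[a/ℕn]*n x N) ⟩
    (+ r + q * + N) - + r    ≡⟨ cancel (+ r) (q * + N) ⟩
    q * + N                  ∎
    where
    r = x ℤD.%ℕ N
    q = x ℤD./ℕ N
    cancel : ∀ a b → (a + b) - a ≡ b
    cancel = solve-∀
  cover : ∀ x → Any (λ r → Square N (x -² r)) (map point (cartesianProduct (upTo N) (upTo N)))
  cover (x₁ , x₂) = Any.map (λ { refl → x₁ ℤD./ℕ N , x₂ ℤD./ℕ N , cong₂ _,_ (quotient x₁) (quotient x₂) })
    (∈-map⁺ point (∈-cartesianProduct⁺ (∈-upTo⁺ (ℤD.n%ℕd<d x₁ N)) (∈-upTo⁺ (ℤD.n%ℕd<d x₂ N))))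

square-periods : ∀ {A : Set} (f : ℤ² → A) {N l} → Period f (+ N , 0ℤ) → Period f (0ℤ , + N)
               → Square N l → Period f l
square-periods f {N} p₁ p₂ (k₁ , k₂ , refl) =
  subst (Period f) (cong₂ _,_ (axis₁ k₁ k₂ (+ N)) (axis₂ k₁ k₂ (+ N))) (period-lincomb f p₁ p₂ k₁ k₂)
  where
  axis₁ : ∀ a b M → a * M + b * 0ℤ ≡ a * M
  axis₁ = solve-∀
  axis₂ : ∀ a b M → a * 0ℤ + b * M ≡ b * M
  axis₂ = solve-∀

SquarePeriodic : {A : Set} → (ℤ² → A) → Set
SquarePeriodic f = Σ ℕ λ n → Period f (+ suc n , 0ℤ) × Period f (0ℤ , + suc n)

-- Two periods a, c with det(a, c) = D ≠ 0 make f square-periodic with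
-- modulus |D|, since c₂a − a₂c = (D, 0) and a₁c − c₁a = (0, D).

det : ℤ² → ℤ² → ℤ
det (a₁ , a₂) (b₁ , b₂) = a₁ * b₂ - a₂ * b₁

det-scaleʳ : ∀ a b k → det a (k ·² b) ≡ k * det a b
det-scaleʳ (a₁ , a₂) (b₁ , b₂) k = scale a₁ a₂ b₁ b₂ k
  where
  scale : ∀ p q r t m → p * (m * t) - q * (m * r) ≡ m * (p * t - q * r)
  scale = solve-∀

module _ {A : Set} (f : ℤ² → A) where

  axis-periods : ∀ {a c} → Period f a → Period f c
               → Period f (det a c , 0ℤ) × Period f (0ℤ , det a c)
  axis-periods {a₁ , a₂} {c₁ , c₂} pa pc =
      subst (Period f) (cong₂ _,_ (first₁ a₁ a₂ c₁ c₂) (first₂ a₁ a₂ c₁ c₂))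
        (period-lincomb f pa pc c₂ (- a₂))
    , subst (Period f) (cong₂ _,_ (second₁ a₁ a₂ c₁ c₂) (second₂ a₁ a₂ c₁ c₂))
        (period-lincomb f pa pc (- c₁) a₁)
    where
    first₁ : ∀ p q r t → t * p + (- q) * r ≡ p * t - q * r
    first₁ = solve-∀
    first₂ : ∀ p q r t → t * q + (- q) * t ≡ 0ℤ
    first₂ = solve-∀
    second₁ : ∀ p q r t → (- r) * p + p * r ≡ 0ℤ
    second₁ = solve-∀
    second₂ : ∀ p q r t → (- r) * q + p * t ≡ p * t - q * r
    second₂ = solve-∀

  square-from-axes : ∀ D → D ≢ 0ℤ → Period f (D , 0ℤ) → Period f (0ℤ , D) → SquarePeriodic f
  square-from-axes (+ zero)  D≢0 _  _  = ⊥-elim (D≢0 refl)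
  square-from-axes (+ suc n) _   p₁ p₂ = n , p₁ , p₂
  square-from-axes -[1+ n ]  _   p₁ p₂ = n , period-neg f p₁ , period-neg f p₂

  independent-periods : ∀ {a c} → Period f a → Period f c → det a c ≢ 0ℤ → SquarePeriodic f
  independent-periods {a} {c} pa pc D≢0 =
    let (p₁ , p₂) = axis-periods pa pc in square-from-axes (det a c) D≢0 p₁ p₂

Δ : ℤ² → (ℤ² → ℤ) → (ℤ² → ℤ)
Δ b g x = g (x +² b) - g x

Δs : List ℤ² → (ℤ² → ℤ) → (ℤ² → ℤ)
Δs []       g = g
Δs (b ∷ bs) g = Δs bs (Δ b g)

Constant : (ℤ² → ℤ) → Set
Constant g = ∀ x y → g x ≡ g y

Vanishes : (ℤ² → ℤ) → Set
Vanishes g = ∀ x → g x ≡ 0ℤ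

period⇒Δ-vanishes : ∀ {g b} → Period g b → Vanishes (Δ b g)
period⇒Δ-vanishes {g} pb x = trans (cong (_- g x) (pb x)) (ℤP.+-inverseʳ (g x))

Δ-vanishes⇒period : ∀ {g b} → Vanishes (Δ b g) → Period g b
Δ-vanishes⇒period {g} {b} z x = ℤP.i-j≡0⇒i≡j (g (x +² b)) (g x) (z x)

-- Δ_b commutes with translation by u, so it preserves the period u.
Δ-period : ∀ {g u} b → Period g u → Period (Δ b g) u
Δ-period {g} {u} b pu x = cong₂ _-_ (trans (cong g (+²-swap x u b)) (pu (x +² b))) (pu x)

-- Both sides are the second difference g(x+b+c) − g(x+b) − g(x+c) + g(x).
Δ-comm : ∀ g b c x → Δ c (Δ b g) x ≡ Δ b (Δ c g) x
Δ-comm g b c x = begin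
  (g ((x +² c) +² b) - g (x +² c)) - (g (x +² b) - g x)  ≡⟨ cong (λ t → (t - g (x +² c)) - (g (x +² b) - g x)) (cong g (+²-swap x c b)) ⟩
  (g ((x +² b) +² c) - g (x +² c)) - (g (x +² b) - g x)  ≡⟨ exchange (g ((x +² b) +² c)) (g (x +² c)) (g (x +² b)) (g x) ⟩
  (g ((x +² b) +² c) - g (x +² b)) - (g (x +² c) - g x)  ∎
  where
  exchange : ∀ p q r t → (p - q) - (r - t) ≡ (p - r) - (q - t)
  exchange = solve-∀

Δs-cong : ∀ bs {g g′} → (∀ x → g x ≡ g′ x) → ∀ x → Δs bs g x ≡ Δs bs g′ x
Δs-cong []       e = e
Δs-cong (b ∷ bs) e = Δs-cong bs (λ x → cong₂ _-_ (e (x +² b)) (e x))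

Δs-vanishes : ∀ bs {g} → Vanishes g → Vanishes (Δs bs g)
Δs-vanishes []       z = z
Δs-vanishes (b ∷ bs) z = Δs-vanishes bs (λ x → cong₂ _-_ (z (x +² b)) (z x))

Δs-constant : ∀ bs {g} → Constant g → Constant (Δs bs g)
Δs-constant []       k = k
Δs-constant (b ∷ bs) k = Δs-constant bs (λ x y → cong₂ _-_ (k (x +² b) (y +² b)) (k x y))

Δs-kill : ∀ bs {g} → Any (Period g) bs → Vanishes (Δs bs g)
Δs-kill (b ∷ bs) (here pb)  = Δs-vanishes bs (period⇒Δ-vanishes pb)
Δs-kill (b ∷ bs) (there pa) = Δs-kill bs (Any.map (Δ-period b) pa)

Δs-+ : ∀ bs g g′ x → Δs bs (λ y → g y + g′ y) x ≡ Δs bs g x + Δs bs g′ x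
Δs-+ []       g g′ x = refl
Δs-+ (b ∷ bs) g g′ x = begin
  Δs bs (Δ b (λ y → g y + g′ y)) x   ≡⟨ Δs-cong bs (λ y → distrib (g (y +² b)) (g′ (y +² b)) (g y) (g′ y)) x ⟩
  Δs bs (λ y → Δ b g y + Δ b g′ y) x ≡⟨ Δs-+ bs (Δ b g) (Δ b g′) x ⟩
  Δs bs (Δ b g) x + Δs bs (Δ b g′) x ∎
  where
  distrib : ∀ p q r t → (p + q) - (r + t) ≡ (p - r) + (q - t)
  distrib = solve-∀

Δs-sum : ∀ bs m (G : Fin m → ℤ² → ℤ) x
       → Δs bs (λ y → sum (λ j → G j y)) x ≡ sum (λ j → Δs bs (G j) x)
Δs-sum bs zero    G x = Δs-vanishes bs (λ _ → refl) x
Δs-sum bs (suc m) G x = begin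
  Δs bs (λ y → G Fin.zero y + sum (λ j → G (Fin.suc j) y)) x
    ≡⟨ Δs-+ bs (G Fin.zero) (λ y → sum (λ j → G (Fin.suc j) y)) x ⟩
  Δs bs (G Fin.zero) x + Δs bs (λ y → sum (λ j → G (Fin.suc j) y)) x
    ≡⟨ cong (λ t → Δs bs (G Fin.zero) x + t) (Δs-sum bs m (λ j → G (Fin.suc j)) x) ⟩
  Δs bs (G Fin.zero) x + sum (λ j → Δs bs (G (Fin.suc j)) x)
    ∎

-- Bounded functions cannot grow linearly: if Δ_c f is c-periodic then
-- f (x + k c) = f x + k · Δ_c f (x), so boundedness forces Δ_c f = 0.

Bounded : (ℤ² → ℤ) → ℕ → Set
Bounded g B = ∀ x → ∣ g x ∣ ℕ.≤ B

walk : ℕ → ℤ² → ℤ² → ℤ²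
walk zero    c x = x
walk (suc k) c x = walk k c x +² c

period-walk : ∀ {A : Set} {h : ℤ² → A} {c} → Period h c → ∀ k x → h (walk k c x) ≡ h x
period-walk         pc zero    x = refl
period-walk {c = c} pc (suc k) x = trans (pc (walk k c x)) (period-walk pc k x)

module _ (g : ℤ² → ℤ) where

  difference-bounded : ∀ {B} → Bounded g B → ∀ x y → ∣ g x - g y ∣ ℕ.≤ B ℕ.+ B
  difference-bounded bd x y =
    ℕP.≤-trans (ℤP.∣i-j∣≤∣i∣+∣j∣ (g x) (g y)) (ℕP.+-mono-≤ (bd x) (bd y))

  Δ-bounded : ∀ {B} b → Bounded g B → Bounded (Δ b g) (B ℕ.+ B)
  Δ-bounded b bd x = difference-bounded bd (x +² b) x

  linear-growth : ∀ {c} → Period (Δ c g) c → ∀ k x → g (walk k c x) ≡ g x + + k * Δ c g x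
  linear-growth {c} pc zero x =
    sym (trans (cong (λ t → g x + t) (ℤP.*-zeroˡ (Δ c g x))) (ℤP.+-identityʳ (g x)))
  linear-growth {c} pc (suc k) x = begin
    g (walk k c x +² c)                  ≡⟨ step (g (walk k c x +² c)) (g (walk k c x)) ⟩
    g (walk k c x) + Δ c g (walk k c x)  ≡⟨ cong₂ _+_ (linear-growth pc k x) (period-walk pc k x) ⟩
    (g x + + k * Δ c g x) + Δ c g x      ≡⟨ grow (g x) (+ k) (Δ c g x) ⟩
    g x + + suc k * Δ c g x              ∎
    where
    step : ∀ p q → p ≡ q + (p - q)
    step = solve-∀
    grow : ∀ a m s → (a + m * s) + s ≡ a + (1ℤ + m) * s
    grow = solve-∀

  -- Along 2B + 1 steps a nonzero slope would displace g by more than 2B.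
  bounded-no-growth : ∀ {B c} → Bounded g B → Period (Δ c g) c → Vanishes (Δ c g)
  bounded-no-growth {B} {c} bd pc x with Δ c g x ≟ 0ℤ
  ... | yes s≡0 = s≡0
  ... | no  s≢0 = ⊥-elim (ℕP.<-irrefl refl (ℕP.<-≤-trans too-large too-small))
    where
    K = suc (B ℕ.+ B)
    s = Δ c g x
    |s|≥1 : 1 ℕ.≤ ∣ s ∣
    |s|≥1 = ℕP.n≢0⇒n>0 (λ |s|≡0 → s≢0 (ℤP.∣i∣≡0⇒i≡0 |s|≡0))
    displacement : + K * s ≡ g (walk K c x) - g x
    displacement = begin
      + K * s                ≡⟨ cancel (g x) (+ K * s) ⟨
      (g x + + K * s) - g x  ≡⟨ cong (_- g x) (linear-growth pc K x) ⟨
      g (walk K c x) - g x   ∎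
      where
      cancel : ∀ a t → (a + t) - a ≡ t
      cancel = solve-∀
    too-small : ∣ + K * s ∣ ℕ.≤ B ℕ.+ B
    too-small = subst (λ t → ∣ t ∣ ℕ.≤ B ℕ.+ B) (sym displacement) (difference-bounded bd (walk K c x) x)
    too-large : B ℕ.+ B ℕ.< ∣ + K * s ∣
    too-large = subst (B ℕ.+ B ℕ.<_) (sym (ℤP.abs-* (+ K) s))
      (subst (ℕ._≤ K ℕ.* ∣ s ∣) (ℕP.*-identityʳ K) (ℕP.*-monoʳ-≤ K |s|≥1))

-- If Δ_b f is square-periodic with modulus N and f is
-- bounded, then N·b is a period of f: N·b is a period of Δ_b f, so by
-- commuting the differences b is a period of Δ_{Nb} f, hence so is N·b, and
-- a bounded function cannot grow linearly along N·b.

Δ-commute-period : ∀ g b c → Period (Δ b g) c → Period (Δ c g) b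
Δ-commute-period g b c pc =
  Δ-vanishes⇒period (λ x → trans (sym (Δ-comm g b c x)) (period⇒Δ-vanishes pc x))

multiple-period : ∀ f {B} b → Bounded f B → SquarePeriodic (Δ b f)
                → Σ ℕ λ n → Period f (+ suc n ·² b)
multiple-period f b@(b₁ , b₂) bd (n , p₁ , p₂) =
  n , Δ-vanishes⇒period (bounded-no-growth f bd (period-ℤ· (Δ c f) Δcf-period-b N))
  where
  N = + suc n
  c = N ·² b
  Δbf-period-c : Period (Δ b f) c
  Δbf-period-c = square-periods (Δ b f) p₁ p₂ (b₁ , b₂ , cong₂ _,_ (ℤP.*-comm N b₁) (ℤP.*-comm N b₂))
  Δcf-period-b : Period (Δ c f) b
  Δcf-period-b = Δ-commute-period f b c Δbf-period-c

constant-period : ∀ {g} → Constant g → ∀ u → Period g u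
constant-period k u x = k (x +² u) x

det-multiple-≢0 : ∀ a b n → det a b ≢ 0ℤ → det a (+ suc n ·² b) ≢ 0ℤ
det-multiple-≢0 a b n a×b≢0 d =
  [ (λ ()) , a×b≢0 ]′ (ℤP.i*j≡0⇒i≡0∨j≡0 (+ suc n) (trans (sym (det-scaleʳ a b (+ suc n))) d))

difference-periodicity : ∀ a bs → All (λ b → det a b ≢ 0ℤ) bs
  → ∀ f {B} → Bounded f B → Period f a → Constant (Δs bs f) → SquarePeriodic f
difference-periodicity a [] [] f bd pa k = 0 , constant-period k _ , constant-period k _
difference-periodicity a (b ∷ bs) (a×b≢0 ∷ a×bs≢0) f bd pa k =
  let n , pNb = multiple-period f b bd
                  (difference-periodicity a bs a×bs≢0 (Δ b f) (Δ-bounded f b bd) (Δ-period b pa) k)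
  in independent-periods f pa pNb (det-multiple-≢0 a b n a×b≢0)

indicator : ∀ {m} → Fin m → Fin m → ℤ
indicator u j = if does (u Fin.≟ j) then 1ℤ else 0ℤ

module _ {m : ℕ} where

  indicator-refl : ∀ (u : Fin m) → indicator u u ≡ 1ℤ
  indicator-refl u with u Fin.≟ u
  ... | yes _   = refl
  ... | no  u≢u = ⊥-elim (u≢u refl)

  indicator-≢ : ∀ {u j : Fin m} → u ≢ j → indicator u j ≡ 0ℤ
  indicator-≢ {u} {j} u≢j with u Fin.≟ j
  ... | yes u≡j = ⊥-elim (u≢j u≡j)
  ... | no  _   = refl

  indicator-bounded : ∀ (u j : Fin m) → ∣ indicator u j ∣ ℕ.≤ 1
  indicator-bounded u j with u Fin.≟ j
  ... | yes _ = ℕP.≤-refl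
  ... | no  _ = ℕ.z≤n

  ⇔⇒indicator-≡ : ∀ {u v j : Fin m} → (u ≡ j ⇔ v ≡ j) → indicator u j ≡ indicator v j
  ⇔⇒indicator-≡ {u} {v} {j} u⇔v with u Fin.≟ j | v Fin.≟ j
  ... | yes _   | yes _   = refl
  ... | no  _   | no  _   = refl
  ... | yes u≡j | no  v≢j = ⊥-elim (v≢j (Equivalence.to u⇔v u≡j))
  ... | no  u≢j | yes v≡j = ⊥-elim (u≢j (Equivalence.from u⇔v v≡j))

  indicator-≡⇒⇔ : ∀ {u v j : Fin m} → indicator u j ≡ indicator v j → (u ≡ j ⇔ v ≡ j)
  indicator-≡⇒⇔ {u} {v} {j} e with u Fin.≟ j | v Fin.≟ j
  ... | yes u≡j | yes v≡j = mk⇔ (λ _ → v≡j) (λ _ → u≡j)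
  ... | no  u≢j | no  v≢j = mk⇔ (λ u≡j → ⊥-elim (u≢j u≡j)) (λ v≡j → ⊥-elim (v≢j v≡j))
  ... | yes _   | no  _   with () ← e
  ... | no  _   | yes _   with () ← e

sum-vanishes : ∀ m (G : Fin m → ℤ) → (∀ j → G j ≡ 0ℤ) → sum G ≡ 0ℤ
sum-vanishes zero    G z = refl
sum-vanishes (suc m) G z = cong₂ _+_ (z Fin.zero) (sum-vanishes m (λ j → G (Fin.suc j)) (λ j → z (Fin.suc j)))

sum-single : ∀ m (G : Fin m → ℤ) i → (∀ j → j ≢ i → G j ≡ 0ℤ) → sum G ≡ G i
sum-single (suc m) G Fin.zero z = begin
  G Fin.zero + sum (λ j → G (Fin.suc j))  ≡⟨ cong (λ t → G Fin.zero + t) (sum-vanishes m _ (λ j → z (Fin.suc j) (λ ()))) ⟩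
  G Fin.zero + 0ℤ                         ≡⟨ ℤP.+-identityʳ (G Fin.zero) ⟩
  G Fin.zero                              ∎
sum-single (suc m) G (Fin.suc i) z = begin
  G Fin.zero + sum (λ j → G (Fin.suc j))  ≡⟨ cong₂ _+_ (z Fin.zero (λ ())) (sum-single m _ i (λ j j≢i → z (Fin.suc j) (λ e → j≢i (suc-injective e)))) ⟩
  0ℤ + G (Fin.suc i)                      ≡⟨ ℤP.+-identityˡ (G (Fin.suc i)) ⟩
  G (Fin.suc i)                           ∎

sum-indicator : ∀ m (u : Fin m) → sum (indicator u) ≡ 1ℤ
sum-indicator m u = trans (sum-single m (indicator u) u (λ j j≢u → indicator-≢ (λ u≡j → j≢u (sym u≡j))))
                          (indicator-refl u)

-- If G₀, …, G_{m−1} sum to a constant and every Gⱼ with j ≠ i has a period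
-- among the bs, then Δs bs Gᵢ is constant: it equals Δs bs applied to the sum.
Δs-isolate : ∀ {m} (G : Fin m → ℤ² → ℤ) i bs → Constant (λ x → sum (λ j → G j x))
           → (∀ j → j ≢ i → Any (Period (G j)) bs) → Constant (Δs bs (G i))
Δs-isolate {m} G i bs k killed x y = begin
  Δs bs (G i) x                      ≡⟨ isolate x ⟩
  sum (λ j → Δs bs (G j) x)          ≡⟨ Δs-sum bs m G x ⟨
  Δs bs (λ z → sum (λ j → G j z)) x  ≡⟨ Δs-constant bs k x y ⟩
  Δs bs (λ z → sum (λ j → G j z)) y  ≡⟨ Δs-sum bs m G y ⟩
  sum (λ j → Δs bs (G j) y)          ≡⟨ isolate y ⟨
  Δs bs (G i) y                      ∎
  where
  isolate : ∀ z → Δs bs (G i) z ≡ sum (λ j → Δs bs (G j) z)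
  isolate z = sym (sum-single m (λ j → Δs bs (G j) z) i (λ j j≢i → Δs-kill bs (killed j j≢i) z))

others : ∀ {m} → Fin m → List (Fin m)
others {m} i = filter (λ j → ¬? (j Fin.≟ i)) (allFin m)

-- An integer relation p·a + q·b = 0 with (p, q) ≠ 0
-- is a rational one, and det(a, b) = 0 yields such a relation: both
-- (b₁, −a₁) and (b₂, −a₂) are relations, and they vanish only if a = b = 0.

ι : ℤ → ℚ
ι x = x ℚ./ 1

ι-mkℚ : ∀ x → ι x ≡ mkℚ x 0 (Coprimality.sym (Coprimality.1-coprimeTo ∣ x ∣))
ι-mkℚ (+ n)    = normalize-coprime {n} {0} _
ι-mkℚ -[1+ n ] = cong ℚ.-_ (normalize-coprime {suc n} {0} _)

ι-* : ∀ x y → ι x ℚ.* ι y ≡ ι (x * y)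
ι-* x y rewrite ι-mkℚ x | ι-mkℚ y = refl

ι-+ : ∀ x y → ι x ℚ.+ ι y ≡ ι (x * 1ℤ + y * 1ℤ)
ι-+ x y rewrite ι-mkℚ x | ι-mkℚ y = refl

ι-injective-0 : ∀ x → ι x ≡ ℚ.0ℚ → x ≡ 0ℤ
ι-injective-0 x e = trans (cong ℚ.↥_ (sym (ι-mkℚ x))) (cong ℚ.↥_ e)

ι-relation : ∀ p q a b → p * a + q * b ≡ 0ℤ → ι p ℚ.* ι a ℚ.+ ι q ℚ.* ι b ≡ ℚ.0ℚ
ι-relation p q a b e = begin
  ι p ℚ.* ι a ℚ.+ ι q ℚ.* ι b        ≡⟨ cong₂ ℚ._+_ (ι-* p a) (ι-* q b) ⟩
  ι (p * a) ℚ.+ ι (q * b)            ≡⟨ ι-+ (p * a) (q * b) ⟩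
  ι (p * a * 1ℤ + q * b * 1ℤ)        ≡⟨ cong ι (cong₂ _+_ (ℤP.*-identityʳ (p * a)) (ℤP.*-identityʳ (q * b))) ⟩
  ι (p * a + q * b)                  ≡⟨ cong ι e ⟩
  ι 0ℤ                               ∎

relation⇒proportional : ∀ a₁ a₂ b₁ b₂ p q → ¬ (p ≡ 0ℤ × q ≡ 0ℤ)
  → p * a₁ + q * b₁ ≡ 0ℤ → p * a₂ + q * b₂ ≡ 0ℤ → Proportional (a₁ , a₂) (b₁ , b₂)
relation⇒proportional a₁ a₂ b₁ b₂ p q pq≢0 e₁ e₂ =
    ι p , ι q
  , (λ (p≡0 , q≡0) → pq≢0 (ι-injective-0 p p≡0 , ι-injective-0 q q≡0))
  , ι-relation p q a₁ b₁ e₁ , ι-relation p q a₂ b₂ e₂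

relation-diagonal : ∀ x y → y * x + (- x) * y ≡ 0ℤ
relation-diagonal = solve-∀

relation-cross₁ : ∀ a₁ a₂ b₁ b₂ → det (a₁ , a₂) (b₁ , b₂) ≡ 0ℤ → b₁ * a₂ + (- a₁) * b₂ ≡ 0ℤ
relation-cross₁ a₁ a₂ b₁ b₂ d = trans (cross a₁ a₂ b₁ b₂) (cong -_ d)
  where
  cross : ∀ p q r t → r * q + (- p) * t ≡ - (p * t - q * r)
  cross = solve-∀

relation-cross₂ : ∀ a₁ a₂ b₁ b₂ → det (a₁ , a₂) (b₁ , b₂) ≡ 0ℤ → b₂ * a₁ + (- a₂) * b₁ ≡ 0ℤ
relation-cross₂ a₁ a₂ b₁ b₂ d = trans (cross a₁ a₂ b₁ b₂) d
  where
  cross : ∀ p q r t → t * p + (- q) * r ≡ p * t - q * r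
  cross = solve-∀

det0⇒proportional : ∀ a b → det a b ≡ 0ℤ → Proportional a b
det0⇒proportional (a₁ , a₂) (b₁ , b₂) d
  with (b₁ ≟ 0ℤ) ×-dec (a₁ ≟ 0ℤ) | (b₂ ≟ 0ℤ) ×-dec (a₂ ≟ 0ℤ)
... | no ¬zero₁ | _ =
  relation⇒proportional a₁ a₂ b₁ b₂ b₁ (- a₁) (λ (b₁≡0 , -a₁≡0) → ¬zero₁ (b₁≡0 , ℤP.neg-injective -a₁≡0))
    (relation-diagonal a₁ b₁) (relation-cross₁ a₁ a₂ b₁ b₂ d)
... | yes _ | no ¬zero₂ =
  relation⇒proportional a₁ a₂ b₁ b₂ b₂ (- a₂) (λ (b₂≡0 , -a₂≡0) → ¬zero₂ (b₂≡0 , ℤP.neg-injective -a₂≡0))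
    (relation-cross₂ a₁ a₂ b₁ b₂ d) (relation-diagonal a₂ b₂)
... | yes (refl , refl) | yes (refl , refl) =
  relation⇒proportional 0ℤ 0ℤ 0ℤ 0ℤ 1ℤ 0ℤ (λ ()) refl refl

proposition2p1 : (m : ℕ) (c : ℤ² → Fin m) (h : Fin m → ℤ²)
    → (∀ i x → (c x ≡ i) ⇔ (c (x +² h i) ≡ i))
    → (∀ i j → i ≢ j → ¬ Proportional (h i) (h j))
    → ∀ i → Σ (ℤ² → Set) (λ Λ → IsSubgroup Λ × FiniteIndex Λ
        × (∀ x l → Λ l → (c x ≡ i) ⇔ (c (x +² l) ≡ i)))
proposition2p1 m c h invariant non-proportional i =
  let n , p₁ , p₂ = difference-periodicity (h i) bs independent (𝟙 i)
                      (λ x → indicator-bounded (c x) i) (𝟙-period i) constant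
  in  Square (suc n) , square-subgroup (suc n) , square-finiteIndex n
    , λ x l l∈Λ → indicator-≡⇒⇔ (sym (square-periods (𝟙 i) p₁ p₂ l∈Λ x))
  where
  𝟙 : Fin m → ℤ² → ℤ
  𝟙 j x = indicator (c x) j
  𝟙-period : ∀ j → Period (𝟙 j) (h j)
  𝟙-period j x = sym (⇔⇒indicator-≡ (invariant j x))
  bs = map h (others i)
  killed : ∀ j → j ≢ i → Any (Period (𝟙 j)) bs
  killed j j≢i = Any.map (λ { refl → 𝟙-period j }) (∈-map⁺ h (∈-filter⁺ _ (∈-allFin j) j≢i))
  independent : All (λ b → det (h i) b ≢ 0ℤ) bs
  independent = AllP.map⁺ (All.map (λ {j} j≢i d → non-proportional i j (λ i≡j → j≢i (sym i≡j))
                                                   (det0⇒proportional (h i) (h j) d))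
                                   (all-filter _ (allFin m)))
  constant : Constant (Δs bs (𝟙 i))
  constant = Δs-isolate 𝟙 i bs (λ x y → trans (sum-indicator m (c x)) (sym (sum-indicator m (c y)))) killed
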